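{- Let $n,m$ be positive integers with $m>3$, and let $G$ be a graph with $n$ vertices, $m$ edges and minimum degree at least $2$. Then \[ N_{ind}(C_4,G)\le\frac{m(m-n+1)}{4}. \]
   Context: $N_{ind}(C_4,G)$ denotes the number of induced copies of the 4-cycle $C_4$ in $G$. -}

module Defs where

open import Data.Nat using (ℕ; _<_)
open import Data.Bool using (Bool; true; false; _∧_; _∨_; not; if_then_else_)
open import Data.Fin using (Fin; toℕ)
open import Data.Fin.Properties using (_<?_)
open import Data.List using (List; filter; length; allFin; concatMap; _∷_; [])
open import Data.Product using (_×_; _,_)
open import Relation.Binary.PropositionalEquality using (_≡_)
open import Relation.Nullary.Decidable using (does)

record Graph (n : ℕ) : Set where
  field
    adj   : Fin n → Fin n → Bool
    sym   : ∀ i j → adj i j ≡ adj j i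
    irrefl : ∀ i → adj i i ≡ false
open Graph public

vertices : (n : ℕ) → List (Fin n)
vertices n = allFin n

degree : ∀ {n} → Graph n → Fin n → ℕ
degree {n} G v = length (filter (λ w → adj G v w Data.Bool.≟ true) (vertices n))

pairs : (n : ℕ) → List (Fin n × Fin n)
pairs n = concatMap (λ i → concatMap (λ j → if does (i <? j) then (i , j) ∷ [] else []) (vertices n)) (vertices n)

edgeCount : ∀ {n} → Graph n → ℕ
edgeCount {n} G = length (filter (λ p → adj G (Data.Product.proj₁ p) (Data.Product.proj₂ p) Data.Bool.≟ true) (pairs n))

-- 4-element vertex subsets {a,b,c,d} with a < b < c < d
Quad : ℕ → Set
Quad n = Fin n × Fin n × Fin n × Fin n

quads : (n : ℕ) → List (Quad n)
quads n = concatMap (λ a → concatMap (λ b → concatMap (λ c → concatMap (λ d →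
  if does (a <? b) ∧ does (b <? c) ∧ does (c <? d) then (a , b , c , d) ∷ [] else [])
  (vertices n)) (vertices n)) (vertices n)) (vertices n)

cyc : ∀ {n} → Graph n → Fin n → Fin n → Fin n → Fin n → Bool
cyc G a x y z = adj G a x ∧ adj G x y ∧ adj G y z ∧ adj G z a ∧ not (adj G a y) ∧ not (adj G x z)

-- the induced subgraph on a 4-set is isomorphic to C4 (one of the three
-- possible 4-cycles on four labelled vertices)
inducesC4 : ∀ {n} → Graph n → Quad n → Bool
inducesC4 G (a , b , c , d) = cyc G a b c d ∨ cyc G a b d c ∨ cyc G a c b d

NindC4 : ∀ {n} → Graph n → ℕ
NindC4 {n} G = length (filter (λ q → inducesC4 G q Data.Bool.≟ true) (quads n))

module Submission where

-- For an edge uv let A = N(u) ∖ N[v] and B = N(v) ∖ N[u]. The induced 4-cycles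
-- through uv are the cycles u–v–x–y–u with x ∈ B, y ∈ A and xy an edge, and each
-- induced 4-cycle is met in this way once for each of its four edges; so 4 N is at
-- most the sum over the edges uv of the number K(uv) of edges between B and A.
-- Counting edge ends, u sees v and A, v sees u and B, every vertex of A sees u and
-- its neighbours in B, every vertex of B sees v and its neighbours in A, and each of
-- the n − 2 − |A| − |B| remaining vertices has degree at least 2. Hence
-- 2m ≥ 2 + 2|A| + 2|B| + 2K(uv) + 2(n − 2 − |A| − |B|), that is K(uv) ≤ m − n + 1,
-- and summing over the m edges gives 4 N ≤ m (m − n + 1).
--
-- Induced copies are enumerated as sorted quadruples a < b < c < d; matching them
-- with the tuples (u, v, x, y) with u < v and x < y rests on the six interleavings
-- of two ordered pairs being mutually exclusive.

module C4Counting where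

  open import Data.Bool using (Bool; true; false; _∧_; _∨_; not; T; if_then_else_)
  import Data.Bool as Bool
  open import Data.List using (List; []; _∷_; _++_; length; filter; concatMap; tabulate; allFin)
  open import Data.List.Properties using (filter-++; length-++)
  open import Data.Bool.Properties using (∧-commutativeMonoid; T-∧)
  open import Function.Bundles using (Equivalence)
  open import Algebra.Bundles using (CommutativeMonoid)
  open import Algebra.Properties.CommutativeSemigroup
    (CommutativeMonoid.commutativeSemigroup ∧-commutativeMonoid) using (x∙yz≈y∙xz)
  open import Data.Empty using (⊥; ⊥-elim)
  open import Data.Fin using (Fin; zero; suc; _<_)
  import Data.Fin.Properties as Finₚ
  open Finₚ using (_<?_; _≟_; <-trans; <-asym; <-cmp; <⇒≢)
  open import Data.Nat using (ℕ; zero; suc; _+_; _*_; _∸_; _≤_; z≤n; s≤s)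
  open import Data.Nat.Properties hiding (_≟_; _<?_; <-trans; <-asym; <-cmp; <⇒≢; >⇒≢)
  open import Data.Nat.Tactic.RingSolver using (solve-∀)
  open import Data.Product using (_×_; _,_; proj₁; proj₂)
  open import Data.Sum using (_⊎_; inj₁; inj₂; [_,_])
  open import Function using (_∘_; id)
  open import Relation.Binary using (tri<; tri≈; tri>)
  open import Relation.Binary.PropositionalEquality hiding ([_])
  open import Relation.Nullary using (Dec; yes; ¬_)
  open import Relation.Nullary.Decidable using (does; dec-true; dec-false)

  open import Algebra.Properties.Semiring.Sum +-*-semiring
    using (sum; ∑-distrib-+; ∑-comm; sum-cong-≗; sum-replicate-zero; *-distribˡ-sum; *-distribʳ-sum)

  open import Defs renaming (sym to adj-sym)

  ∧-elim : ∀ x {y} → T (x ∧ y) → T x × T y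
  ∧-elim x = Equivalence.to (T-∧ {x})

  ∧-intro : ∀ {x y} → T x → T y → T (x ∧ y)
  ∧-intro {x} p q = Equivalence.from (T-∧ {x}) (p , q)

  ∨-elim : ∀ {x y} → T (x ∨ y) → T x ⊎ T y
  ∨-elim {true}  t = inj₁ t
  ∨-elim {false} t = inj₂ t

  not-contra : ∀ {x} → T (not x) → T x → ⊥
  not-contra {false} _ ()

  does-elim : ∀ {a} {A : Set a} (a? : Dec A) → T (does a?) → A
  does-elim (yes a) _ = a

  does-intro : ∀ {a} {A : Set a} (a? : Dec A) → A → T (does a?)
  does-intro a? a = subst T (sym (dec-true a? a)) _

  does-introFalse : ∀ {a} {A : Set a} (a? : Dec A) → ¬ A → T (not (does a?))
  does-introFalse a? ¬a = subst (T ∘ not) (sym (dec-false a? ¬a)) _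

  𝟙 : Bool → ℕ
  𝟙 true  = 1
  𝟙 false = 0

  𝟙-≤1 : ∀ x → 𝟙 x ≤ 1
  𝟙-≤1 true  = ≤-refl
  𝟙-≤1 false = z≤n

  𝟙-∧ : ∀ x y → 𝟙 (x ∧ y) ≡ 𝟙 x * 𝟙 y
  𝟙-∧ true  y = sym (+-identityʳ (𝟙 y))
  𝟙-∧ false y = refl

  𝟙-∨-≤ : ∀ x y → 𝟙 (x ∨ y) ≤ 𝟙 x + 𝟙 y
  𝟙-∨-≤ true  y = s≤s z≤n
  𝟙-∨-≤ false y = ≤-refl

  𝟙-mono : ∀ {x y} → (T x → T y) → 𝟙 x ≤ 𝟙 y
  𝟙-mono {false}         _   = z≤n
  𝟙-mono {true} {true}  _   = ≤-refl
  𝟙-mono {true} {false} x⇒y = ⊥-elim (x⇒y _)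

  𝟙-disjoint : ∀ {x y} → (T x → T y → ⊥) → 𝟙 x + 𝟙 y ≡ 𝟙 (x ∨ y)
  𝟙-disjoint {true} {true}  x⊥y = ⊥-elim (x⊥y _ _)
  𝟙-disjoint {true} {false} _   = refl
  𝟙-disjoint {false}        _   = refl

  𝟙-disjoint-≤ : ∀ {x y z} → (T x → T y → ⊥) → (T x → T z) → (T y → T z) → 𝟙 x + 𝟙 y ≤ 𝟙 z
  𝟙-disjoint-≤ {x} {y} {z} x⊥y x⇒z y⇒z = begin
    𝟙 x + 𝟙 y  ≡⟨ 𝟙-disjoint x⊥y ⟩
    𝟙 (x ∨ y)  ≤⟨ 𝟙-mono ([ x⇒z , y⇒z ] ∘ ∨-elim) ⟩
    𝟙 z        ∎
    where
    open ≤-Reasoning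

  𝟙-guard : ∀ x {m n} → (T x → m ≤ n) → 𝟙 x * m ≤ 𝟙 x * n
  𝟙-guard true  m≤n = *-monoʳ-≤ 1 (m≤n _)
  𝟙-guard false _   = z≤n

  𝟙-≤-∧⁴ : ∀ {s} a b c d → (T s → T a × T b × T c × T d) → 𝟙 s ≤ 𝟙 a * 𝟙 b * (𝟙 c * 𝟙 d)
  𝟙-≤-∧⁴ {s} a b c d s⇒ = begin
    𝟙 s                     ≤⟨ 𝟙-mono (λ t → let p , q , r , w = s⇒ t in ∧-intro (∧-intro p q) (∧-intro r w)) ⟩
    𝟙 ((a ∧ b) ∧ (c ∧ d))   ≡⟨ trans (𝟙-∧ (a ∧ b) (c ∧ d)) (cong₂ _*_ (𝟙-∧ a b) (𝟙-∧ c d)) ⟩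
    𝟙 a * 𝟙 b * (𝟙 c * 𝟙 d) ∎
    where open ≤-Reasoning

  sum-mono-≤ : ∀ {n} {f g : Fin n → ℕ} → (∀ i → f i ≤ g i) → sum f ≤ sum g
  sum-mono-≤ {zero}  _   = z≤n
  sum-mono-≤ {suc n} f≤g = +-mono-≤ (f≤g zero) (sum-mono-≤ (f≤g ∘ suc))

  sum-ones : ∀ n → sum {n} (λ _ → 1) ≡ n
  sum-ones zero    = refl
  sum-ones (suc n) = cong suc (sum-ones n)

  ∑₂ : ∀ {n} → (Fin n → Fin n → ℕ) → ℕ
  ∑₂ f = sum (λ i → sum (f i))

  ∑₂-mono-≤ : ∀ {n} {f g : Fin n → Fin n → ℕ} → (∀ i j → f i j ≤ g i j) → ∑₂ f ≤ ∑₂ g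
  ∑₂-mono-≤ f≤g = sum-mono-≤ (λ i → sum-mono-≤ (f≤g i))

  ∑₂-cong : ∀ {n} {f g : Fin n → Fin n → ℕ} → (∀ i j → f i j ≡ g i j) → ∑₂ f ≡ ∑₂ g
  ∑₂-cong f≡g = sum-cong-≗ (λ i → sum-cong-≗ (f≡g i))

  ∑₂-distrib-+ : ∀ {n} (f g : Fin n → Fin n → ℕ) → ∑₂ (λ i j → f i j + g i j) ≡ ∑₂ f + ∑₂ g
  ∑₂-distrib-+ f g = trans (sum-cong-≗ (λ i → ∑-distrib-+ (f i) (g i)))
                           (∑-distrib-+ (λ i → sum (f i)) (λ i → sum (g i)))

  ∑₂-product : ∀ {n} (f g : Fin n → ℕ) → ∑₂ (λ i j → f i * g j) ≡ sum f * sum g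
  ∑₂-product f g = trans (sum-cong-≗ (λ i → sym (*-distribˡ-sum (f i) g)))
                         (sym (*-distribʳ-sum (sum g) f))

  ∑₂-*ˡ : ∀ {n} c (f : Fin n → Fin n → ℕ) → ∑₂ (λ i j → c * f i j) ≡ c * ∑₂ f
  ∑₂-*ˡ c f = trans (sum-cong-≗ (λ i → sym (*-distribˡ-sum c (f i)))) (sym (*-distribˡ-sum c (λ i → sum (f i))))

  ∑₂-*ʳ : ∀ {n} c (f : Fin n → Fin n → ℕ) → ∑₂ (λ i j → f i j * c) ≡ ∑₂ f * c
  ∑₂-*ʳ c f = trans (sum-cong-≗ (λ i → sym (*-distribʳ-sum c (f i)))) (sym (*-distribʳ-sum c (λ i → sum (f i))))

  ∑₄ : ∀ {n} → (Fin n → Fin n → Fin n → Fin n → ℕ) → ℕ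
  ∑₄ F = ∑₂ (λ a b → ∑₂ (F a b))

  ∑₄-*ˡ : ∀ {n} c (F : Fin n → Fin n → Fin n → Fin n → ℕ) → ∑₄ (λ a b x y → c * F a b x y) ≡ c * ∑₄ F
  ∑₄-*ˡ c F = trans (∑₂-cong (λ a b → ∑₂-*ˡ c (F a b))) (∑₂-*ˡ c (λ a b → ∑₂ (F a b)))

  ∑₄-cong : ∀ {n} {F G : Fin n → Fin n → Fin n → Fin n → ℕ} → (∀ a b c d → F a b c d ≡ G a b c d) → ∑₄ F ≡ ∑₄ G
  ∑₄-cong F≡G = ∑₂-cong (λ a b → ∑₂-cong (F≡G a b))

  ∑₄-mono-≤ : ∀ {n} {F G : Fin n → Fin n → Fin n → Fin n → ℕ} → (∀ a b c d → F a b c d ≤ G a b c d) → ∑₄ F ≤ ∑₄ G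
  ∑₄-mono-≤ F≤G = ∑₂-mono-≤ (λ a b → ∑₂-mono-≤ (F≤G a b))

  ∑₄-distrib-+ : ∀ {n} (F G : Fin n → Fin n → Fin n → Fin n → ℕ) →
                 ∑₄ (λ a b c d → F a b c d + G a b c d) ≡ ∑₄ F + ∑₄ G
  ∑₄-distrib-+ F G = trans (∑₂-cong (λ a b → ∑₂-distrib-+ (F a b) (G a b)))
                           (∑₂-distrib-+ (λ a b → ∑₂ (F a b)) (λ a b → ∑₂ (G a b)))

  ∑₄-distrib-+⁶ : ∀ {n} (F₁ F₂ F₃ F₄ F₅ F₆ : Fin n → Fin n → Fin n → Fin n → ℕ) →
    ∑₄ (λ a b c d → F₁ a b c d + F₂ a b c d + F₃ a b c d + F₄ a b c d + F₅ a b c d + F₆ a b c d)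
    ≡ ∑₄ F₁ + ∑₄ F₂ + ∑₄ F₃ + ∑₄ F₄ + ∑₄ F₅ + ∑₄ F₆
  ∑₄-distrib-+⁶ F₁ F₂ F₃ F₄ F₅ F₆ =
    trans (∑₄-distrib-+ _ F₆) (cong (_+ ∑₄ F₆)
    (trans (∑₄-distrib-+ _ F₅) (cong (_+ ∑₄ F₅)
    (trans (∑₄-distrib-+ _ F₄) (cong (_+ ∑₄ F₄)
    (trans (∑₄-distrib-+ _ F₃) (cong (_+ ∑₄ F₃)
    (∑₄-distrib-+ F₁ F₂))))))))

  ∑₄-swap₁₂ : ∀ {n} (F : Fin n → Fin n → Fin n → Fin n → ℕ) → ∑₄ F ≡ ∑₄ (λ a b c d → F b a c d)
  ∑₄-swap₁₂ F = ∑-comm (λ a b → ∑₂ (F a b))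

  ∑₄-swap₂₃ : ∀ {n} (F : Fin n → Fin n → Fin n → Fin n → ℕ) → ∑₄ F ≡ ∑₄ (λ a b c d → F a c b d)
  ∑₄-swap₂₃ F = sum-cong-≗ (λ a → ∑-comm (λ b c → sum (F a b c)))

  ∑₄-swap₃₄ : ∀ {n} (F : Fin n → Fin n → Fin n → Fin n → ℕ) → ∑₄ F ≡ ∑₄ (λ a b c d → F a b d c)
  ∑₄-swap₃₄ F = ∑₂-cong (λ a b → ∑-comm (F a b))

  _≡ᵇ_ _<ᵇ_ : ∀ {n} → Fin n → Fin n → Bool
  i ≡ᵇ j = does (i ≟ j)
  i <ᵇ j = does (i <? j)

  <ᵇ-intro : ∀ {n} {i j : Fin n} → i < j → T (i <ᵇ j)
  <ᵇ-intro {i = i} {j} = does-intro (i <? j)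

  sum-δ : ∀ {n} (u : Fin n) → sum (λ i → 𝟙 (i ≡ᵇ u)) ≡ 1
  sum-δ {suc n} zero    = cong suc (sum-replicate-zero n)
  sum-δ {suc n} (suc u) = sum-δ u

  ≢⇒1≤𝟙<ᵇ : ∀ {n} {i j : Fin n} → i ≢ j → 1 ≤ 𝟙 (i <ᵇ j) + 𝟙 (j <ᵇ i)
  ≢⇒1≤𝟙<ᵇ {i = i} {j} i≢j with <-cmp i j
  ... | tri< i<j _ _ = ≤-trans (𝟙-mono {true} (λ _ → <ᵇ-intro i<j)) (m≤m+n _ (𝟙 (j <ᵇ i)))
  ... | tri> _ _ j<i = ≤-trans (𝟙-mono {true} (λ _ → <ᵇ-intro j<i)) (m≤n+m _ (𝟙 (i <ᵇ j)))
  ... | tri≈ _ i≡j _ = ⊥-elim (i≢j i≡j)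

  𝟙<ᵇ-≤1 : ∀ {n} (i j : Fin n) → 𝟙 (i <ᵇ j) + 𝟙 (j <ᵇ i) ≤ 1
  𝟙<ᵇ-≤1 i j = ≤-trans (≤-reflexive (𝟙-disjoint asym)) (𝟙-≤1 _)
    where
    asym : T (i <ᵇ j) → T (j <ᵇ i) → ⊥
    asym i<j j<i = <-asym (does-elim (i <? j) i<j) (does-elim (j <? i) j<i)

  ∑₂-symmetrise : ∀ {n} (f : Fin n → Fin n → ℕ) → ∑₂ (λ x y → 𝟙 (x <ᵇ y) * (f x y + f y x)) ≤ ∑₂ f
  ∑₂-symmetrise f = begin
    ∑₂ (λ x y → 𝟙 (x <ᵇ y) * (f x y + f y x))
      ≡⟨ trans (∑₂-cong (λ x y → *-distribˡ-+ (𝟙 (x <ᵇ y)) (f x y) (f y x)))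
               (∑₂-distrib-+ (λ x y → 𝟙 (x <ᵇ y) * f x y) (λ x y → 𝟙 (x <ᵇ y) * f y x)) ⟩
    ∑₂ (λ x y → 𝟙 (x <ᵇ y) * f x y) + ∑₂ (λ x y → 𝟙 (x <ᵇ y) * f y x)
      ≡⟨ cong (∑₂ (λ x y → 𝟙 (x <ᵇ y) * f x y) +_) (∑-comm (λ x y → 𝟙 (x <ᵇ y) * f y x)) ⟩
    ∑₂ (λ x y → 𝟙 (x <ᵇ y) * f x y) + ∑₂ (λ x y → 𝟙 (y <ᵇ x) * f x y)
      ≡⟨ trans (sym (∑₂-distrib-+ (λ x y → 𝟙 (x <ᵇ y) * f x y) (λ x y → 𝟙 (y <ᵇ x) * f x y)))
               (∑₂-cong (λ x y → sym (*-distribʳ-+ (f x y) (𝟙 (x <ᵇ y)) (𝟙 (y <ᵇ x))))) ⟩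
    ∑₂ (λ x y → (𝟙 (x <ᵇ y) + 𝟙 (y <ᵇ x)) * f x y)
      ≤⟨ ∑₂-mono-≤ (λ x y → ≤-trans (*-monoˡ-≤ (f x y) (𝟙<ᵇ-≤1 x y)) (≤-reflexive (+-identityʳ (f x y)))) ⟩
    ∑₂ f
      ∎
    where open ≤-Reasoning

  -- Sorted quadruples and their six splits

  sorted : ∀ {n} → Fin n → Fin n → Fin n → Fin n → Bool
  sorted a b c d = a <ᵇ b ∧ b <ᵇ c ∧ c <ᵇ d

  <ᵇ∧<ᵇ-elim : ∀ {n} (i j k l : Fin n) → T (i <ᵇ j ∧ k <ᵇ l) → i < j × k < l
  <ᵇ∧<ᵇ-elim i j k l p = let i<j , k<l = ∧-elim (i <ᵇ j) p in does-elim (i <? j) i<j , does-elim (k <? l) k<l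

  sorted-elim : ∀ {n} (a b c d : Fin n) → T (sorted a b c d) → a < b × b < c × c < d
  sorted-elim a b c d s = let a<b , s′ = ∧-elim (a <ᵇ b) s in
    does-elim (a <? b) a<b , <ᵇ∧<ᵇ-elim b c c d s′

  below between above : ∀ {n} → Fin n → Fin n → Fin n → Bool
  below   u v z = z <ᵇ u ∧ z <ᵇ v
  between u v z = u <ᵇ z ∧ z <ᵇ v
  above   u v z = u <ᵇ z ∧ v <ᵇ z

  regions-≤1 : ∀ {n} (u v z : Fin n) → 𝟙 (below u v z) + 𝟙 (between u v z) + 𝟙 (above u v z) ≤ 1
  regions-≤1 u v z = begin
    𝟙 (below u v z) + 𝟙 (between u v z) + 𝟙 (above u v z)
      ≡⟨ cong (_+ 𝟙 (above u v z)) (𝟙-disjoint below⊥between) ⟩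
    𝟙 (below u v z ∨ between u v z) + 𝟙 (above u v z)
      ≡⟨ 𝟙-disjoint notAbove ⟩
    𝟙 _
      ≤⟨ 𝟙-≤1 _ ⟩
    1 ∎
    where
    open ≤-Reasoning
    below⊥between : T (below u v z) → T (between u v z) → ⊥
    below⊥between b m = <-asym (proj₁ (<ᵇ∧<ᵇ-elim z u z v b)) (proj₁ (<ᵇ∧<ᵇ-elim u z z v m))
    notAbove : T (below u v z ∨ between u v z) → T (above u v z) → ⊥
    notAbove bm a with ∨-elim {below u v z} bm
    ... | inj₁ b = <-asym (proj₁ (<ᵇ∧<ᵇ-elim z u z v b)) (proj₁ (<ᵇ∧<ᵇ-elim u z v z a))
    ... | inj₂ m = <-asym (proj₂ (<ᵇ∧<ᵇ-elim u z z v m)) (proj₂ (<ᵇ∧<ᵇ-elim u z v z a))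

  below-intro : ∀ {n} {u v z : Fin n} → z < u → z < v → T (below u v z)
  below-intro z<u z<v = ∧-intro (<ᵇ-intro z<u) (<ᵇ-intro z<v)

  between-intro : ∀ {n} {u v z : Fin n} → u < z → z < v → T (between u v z)
  between-intro u<z z<v = ∧-intro (<ᵇ-intro u<z) (<ᵇ-intro z<v)

  above-intro : ∀ {n} {u v z : Fin n} → u < z → v < z → T (above u v z)
  above-intro u<z v<z = ∧-intro (<ᵇ-intro u<z) (<ᵇ-intro v<z)

  -- An interleaving of u < v with x < y fixes the regions of x and y relative to u and v,
  -- and distinct interleavings fix distinct pairs of regions.
  interleavings-≤ : ∀ {n} (u v x y : Fin n) →
    𝟙 (sorted u v x y) + 𝟙 (sorted u x v y) + 𝟙 (sorted u x y v)
    + 𝟙 (sorted x u v y) + 𝟙 (sorted x u y v) + 𝟙 (sorted x y u v) ≤ 𝟙 (u <ᵇ v) * 𝟙 (x <ᵇ y)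
  interleavings-≤ u v x y = begin
    𝟙 (sorted u v x y) + 𝟙 (sorted u x v y) + 𝟙 (sorted u x y v)
    + 𝟙 (sorted x u v y) + 𝟙 (sorted x u y v) + 𝟙 (sorted x y u v)
      ≤⟨ +-mono-≤ (+-mono-≤ (+-mono-≤ (+-mono-≤ (+-mono-≤ uvxy uxvy) uxyv) xuvy) xuyv) xyuv ⟩
    o * (a₂ * b₂) + o * (a₁ * b₂) + o * (a₁ * b₁) + o * (a₀ * b₂) + o * (a₀ * b₁) + o * (a₀ * b₀)
      ≡⟨ factor o (a₂ * b₂) (a₁ * b₂) (a₁ * b₁) (a₀ * b₂) (a₀ * b₁) (a₀ * b₀) ⟩
    o * (a₂ * b₂ + a₁ * b₂ + a₁ * b₁ + a₀ * b₂ + a₀ * b₁ + a₀ * b₀)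
      ≤⟨ *-monoʳ-≤ o (≤-trans (pairs-≤ a₀ a₁ a₂ b₀ b₁ b₂) (*-mono-≤ (regions-≤1 u v x) (regions-≤1 u v y))) ⟩
    o * 1
      ≡⟨ *-identityʳ o ⟩
    o ∎
    where
    open ≤-Reasoning
    o = 𝟙 (u <ᵇ v) * 𝟙 (x <ᵇ y)
    a₀ = 𝟙 (below u v x)
    a₁ = 𝟙 (between u v x)
    a₂ = 𝟙 (above u v x)
    b₀ = 𝟙 (below u v y)
    b₁ = 𝟙 (between u v y)
    b₂ = 𝟙 (above u v y)
    factor : ∀ o p₁ p₂ p₃ p₄ p₅ p₆ →
      o * p₁ + o * p₂ + o * p₃ + o * p₄ + o * p₅ + o * p₆ ≡ o * (p₁ + p₂ + p₃ + p₄ + p₅ + p₆)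
    factor = solve-∀
    pairs-≤ : ∀ a₀ a₁ a₂ b₀ b₁ b₂ →
      a₂ * b₂ + a₁ * b₂ + a₁ * b₁ + a₀ * b₂ + a₀ * b₁ + a₀ * b₀ ≤ (a₀ + a₁ + a₂) * (b₀ + b₁ + b₂)
    pairs-≤ a₀ a₁ a₂ b₀ b₁ b₂ = ≤-trans (m≤m+n _ (a₁ * b₀ + a₂ * b₀ + a₂ * b₁)) (≤-reflexive (expand a₀ a₁ a₂ b₀ b₁ b₂))
      where
      expand : ∀ a₀ a₁ a₂ b₀ b₁ b₂ →
        a₂ * b₂ + a₁ * b₂ + a₁ * b₁ + a₀ * b₂ + a₀ * b₁ + a₀ * b₀ + (a₁ * b₀ + a₂ * b₀ + a₂ * b₁)
        ≡ (a₀ + a₁ + a₂) * (b₀ + b₁ + b₂)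
      expand = solve-∀
    shape : ∀ {s} r r′ → (T s → T (u <ᵇ v) × T (x <ᵇ y) × T r × T r′) → 𝟙 s ≤ o * (𝟙 r * 𝟙 r′)
    shape = 𝟙-≤-∧⁴ (u <ᵇ v) (x <ᵇ y)
    uvxy : 𝟙 (sorted u v x y) ≤ o * (a₂ * b₂)
    uvxy = shape (above u v x) (above u v y) λ s →
      let u<v , v<x , x<y = sorted-elim u v x y s
          v<y = <-trans v<x x<y
      in <ᵇ-intro u<v , <ᵇ-intro x<y ,
         above-intro (<-trans u<v v<x) v<x , above-intro (<-trans u<v v<y) v<y
    uxvy : 𝟙 (sorted u x v y) ≤ o * (a₁ * b₂)
    uxvy = shape (between u v x) (above u v y) λ s →
      let u<x , x<v , v<y = sorted-elim u x v y s
          u<v = <-trans u<x x<v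
      in <ᵇ-intro u<v , <ᵇ-intro (<-trans x<v v<y) ,
         between-intro u<x x<v , above-intro (<-trans u<v v<y) v<y
    uxyv : 𝟙 (sorted u x y v) ≤ o * (a₁ * b₁)
    uxyv = shape (between u v x) (between u v y) λ s →
      let u<x , x<y , y<v = sorted-elim u x y v s
          x<v = <-trans x<y y<v
      in <ᵇ-intro (<-trans u<x x<v) , <ᵇ-intro x<y ,
         between-intro u<x x<v , between-intro (<-trans u<x x<y) y<v
    xuvy : 𝟙 (sorted x u v y) ≤ o * (a₀ * b₂)
    xuvy = shape (below u v x) (above u v y) λ s →
      let x<u , u<v , v<y = sorted-elim x u v y s
          u<y = <-trans u<v v<y
      in <ᵇ-intro u<v , <ᵇ-intro (<-trans x<u u<y) ,
         below-intro x<u (<-trans x<u u<v) , above-intro u<y v<y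
    xuyv : 𝟙 (sorted x u y v) ≤ o * (a₀ * b₁)
    xuyv = shape (below u v x) (between u v y) λ s →
      let x<u , u<y , y<v = sorted-elim x u y v s
          u<v = <-trans u<y y<v
      in <ᵇ-intro u<v , <ᵇ-intro (<-trans x<u u<y) ,
         below-intro x<u (<-trans x<u u<v) , between-intro u<y y<v
    xyuv : 𝟙 (sorted x y u v) ≤ o * (a₀ * b₀)
    xyuv = shape (below u v x) (below u v y) λ s →
      let x<y , y<u , u<v = sorted-elim x y u v s
          y<v = <-trans y<u u<v
      in <ᵇ-intro u<v , <ᵇ-intro x<y ,
         below-intro (<-trans x<y y<u) (<-trans x<y y<v) , below-intro y<u y<v

  splits : ∀ {n} → (Fin n → Fin n → Fin n → Fin n → ℕ) → Fin n → Fin n → Fin n → Fin n → ℕ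
  splits F a b c d = F a b c d + F a c b d + F a d b c + F b c a d + F b d a c + F c d a b

  ∑₄-splits-≤ : ∀ {n} (F : Fin n → Fin n → Fin n → Fin n → ℕ) →
    ∑₄ (λ a b c d → 𝟙 (sorted a b c d) * splits F a b c d)
    ≤ ∑₄ (λ u v x y → 𝟙 (u <ᵇ v) * 𝟙 (x <ᵇ y) * F u v x y)
  ∑₄-splits-≤ F = begin
    ∑₄ (λ a b c d → 𝟙 (sorted a b c d) * splits F a b c d)
      ≡⟨ trans (∑₄-cong (λ a b c d → distrib (𝟙 (sorted a b c d)) (F a b c d) (F a c b d) (F a d b c)
                                             (F b c a d) (F b d a c) (F c d a b)))
               (∑₄-distrib-+⁶ H₁ H₂ H₃ H₄ H₅ H₆) ⟩
    ∑₄ H₁ + ∑₄ H₂ + ∑₄ H₃ + ∑₄ H₄ + ∑₄ H₅ + ∑₄ H₆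
      ≡⟨ cong₂ _+_ (cong₂ _+_ (cong₂ _+_ (cong₂ _+_ (cong (∑₄ H₁ +_) relabel₂) relabel₃) relabel₄) relabel₅)
                   relabel₆ ⟨
    ∑₄ G₁ + ∑₄ G₂ + ∑₄ G₃ + ∑₄ G₄ + ∑₄ G₅ + ∑₄ G₆
      ≡⟨ trans (∑₄-cong (λ u v x y → distribʳ (F u v x y) (𝟙 (sorted u v x y)) (𝟙 (sorted u x v y)) (𝟙 (sorted u x y v))
                                                      (𝟙 (sorted x u v y)) (𝟙 (sorted x u y v)) (𝟙 (sorted x y u v))))
               (∑₄-distrib-+⁶ G₁ G₂ G₃ G₄ G₅ G₆) ⟨
    ∑₄ (λ u v x y → (𝟙 (sorted u v x y) + 𝟙 (sorted u x v y) + 𝟙 (sorted u x y v)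
                    + 𝟙 (sorted x u v y) + 𝟙 (sorted x u y v) + 𝟙 (sorted x y u v)) * F u v x y)
      ≤⟨ ∑₄-mono-≤ (λ u v x y → *-monoˡ-≤ (F u v x y) (interleavings-≤ u v x y)) ⟩
    ∑₄ (λ u v x y → 𝟙 (u <ᵇ v) * 𝟙 (x <ᵇ y) * F u v x y)
      ∎
    where
    open ≤-Reasoning
    distrib : ∀ s f₁ f₂ f₃ f₄ f₅ f₆ →
      s * (f₁ + f₂ + f₃ + f₄ + f₅ + f₆) ≡ s * f₁ + s * f₂ + s * f₃ + s * f₄ + s * f₅ + s * f₆
    distrib = solve-∀
    distribʳ : ∀ f s₁ s₂ s₃ s₄ s₅ s₆ →
      (s₁ + s₂ + s₃ + s₄ + s₅ + s₆) * f ≡ s₁ * f + s₂ * f + s₃ * f + s₄ * f + s₅ * f + s₆ * f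
    distribʳ = solve-∀
    H₁ H₂ H₃ H₄ H₅ H₆ G₁ G₂ G₃ G₄ G₅ G₆ : _ → _ → _ → _ → ℕ
    H₁ a b c d = 𝟙 (sorted a b c d) * F a b c d
    H₂ a b c d = 𝟙 (sorted a b c d) * F a c b d
    H₃ a b c d = 𝟙 (sorted a b c d) * F a d b c
    H₄ a b c d = 𝟙 (sorted a b c d) * F b c a d
    H₅ a b c d = 𝟙 (sorted a b c d) * F b d a c
    H₆ a b c d = 𝟙 (sorted a b c d) * F c d a b
    G₁ u v x y = 𝟙 (sorted u v x y) * F u v x y
    G₂ u v x y = 𝟙 (sorted u x v y) * F u v x y
    G₃ u v x y = 𝟙 (sorted u x y v) * F u v x y
    G₄ u v x y = 𝟙 (sorted x u v y) * F u v x y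
    G₅ u v x y = 𝟙 (sorted x u y v) * F u v x y
    G₆ u v x y = 𝟙 (sorted x y u v) * F u v x y
    relabel₂ : ∑₄ G₂ ≡ ∑₄ H₂
    relabel₂ = ∑₄-swap₂₃ G₂
    relabel₃ : ∑₄ G₃ ≡ ∑₄ H₃
    relabel₃ = trans (∑₄-swap₂₃ G₃) (∑₄-swap₃₄ (λ a b c d → G₃ a c b d))
    relabel₄ : ∑₄ G₄ ≡ ∑₄ H₄
    relabel₄ = trans (∑₄-swap₂₃ G₄) (∑₄-swap₁₂ (λ a b c d → G₄ a c b d))
    relabel₅ : ∑₄ G₅ ≡ ∑₄ H₅
    relabel₅ = trans (∑₄-swap₂₃ G₅) (trans (∑₄-swap₁₂ (λ a b c d → G₅ a c b d))
                                           (∑₄-swap₃₄ (λ a b c d → G₅ b c a d)))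
    relabel₆ : ∑₄ G₆ ≡ ∑₄ H₆
    relabel₆ = trans (∑₄-swap₂₃ G₆) (trans (∑₄-swap₁₂ (λ a b c d → G₆ a c b d))
                     (trans (∑₄-swap₃₄ (λ a b c d → G₆ b c a d)) (∑₄-swap₂₃ (λ a b c d → G₆ b d a c))))

  module _ {A : Set} (P : A → Bool) where

    private
      P? = λ x → P x Bool.≟ true

    length-filter-tabulate : ∀ {n} (f : Fin n → A) → length (filter P? (tabulate f)) ≡ sum (𝟙 ∘ P ∘ f)
    length-filter-tabulate {zero}  f = refl
    length-filter-tabulate {suc n} f with P (f zero)
    ... | true  = cong suc (length-filter-tabulate (f ∘ suc))
    ... | false = length-filter-tabulate (f ∘ suc)

    length-filter-concatMap : ∀ {B : Set} {n} (g : B → List A) (f : Fin n → B) →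
      length (filter P? (concatMap g (tabulate f))) ≡ sum (λ i → length (filter P? (g (f i))))
    length-filter-concatMap {n = zero}  g f = refl
    length-filter-concatMap {n = suc n} g f = begin
      length (filter P? (g (f zero) ++ concatMap g (tabulate (f ∘ suc))))
        ≡⟨ cong length (filter-++ P? (g (f zero)) _) ⟩
      length (filter P? (g (f zero)) ++ filter P? (concatMap g (tabulate (f ∘ suc))))
        ≡⟨ length-++ (filter P? (g (f zero))) ⟩
      length (filter P? (g (f zero))) + length (filter P? (concatMap g (tabulate (f ∘ suc))))
        ≡⟨ cong (length (filter P? (g (f zero))) +_) (length-filter-concatMap g (f ∘ suc)) ⟩
      sum (λ i → length (filter P? (g (f i))))
        ∎
      where open ≡-Reasoning

    length-filter-if : ∀ b x → length (filter P? (if b then x ∷ [] else [])) ≡ 𝟙 (b ∧ P x)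
    length-filter-if false x = refl
    length-filter-if true  x with P x
    ... | true  = refl
    ... | false = refl

  module _ {n} (G : Graph n) where

    E : Fin n → Fin n → ℕ
    E i j = 𝟙 (adj G i j)

    deg : Fin n → ℕ
    deg i = sum (E i)

    edges : ℕ
    edges = ∑₂ (λ i j → 𝟙 (i <ᵇ j) * E i j)

    degree≡deg : ∀ v → degree G v ≡ deg v
    degree≡deg v = length-filter-tabulate (adj G v) id

    edgeCount≡edges : edgeCount G ≡ edges
    edgeCount≡edges =
      trans (length-filter-concatMap isEdge (λ i → concatMap (pair i) (allFin n)) id) (sum-cong-≗ λ i →
      trans (length-filter-concatMap isEdge (pair i) id) (sum-cong-≗ λ j →
      trans (length-filter-if isEdge (i <ᵇ j) (i , j)) (𝟙-∧ (i <ᵇ j) (adj G i j))))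
      where
      isEdge : Fin n × Fin n → Bool
      isEdge p = adj G (proj₁ p) (proj₂ p)
      pair : Fin n → Fin n → List (Fin n × Fin n)
      pair i j = if i <ᵇ j then (i , j) ∷ [] else []

    adj-symᵀ : ∀ {i j} → T (adj G i j) → T (adj G j i)
    adj-symᵀ {i} {j} = subst T (adj-sym G i j)

    ¬adj-symᵀ : ∀ {i j} → T (not (adj G i j)) → T (not (adj G j i))
    ¬adj-symᵀ {i} {j} = subst (T ∘ not) (adj-sym G i j)

    adj⇒≢ : ∀ {i j : Fin n} → T (adj G i j) → i ≢ j
    adj⇒≢ {i} i~j refl = subst T (irrefl G i) i~j

    E-≤ : ∀ i j → E i j ≤ 𝟙 (i <ᵇ j) * E i j + 𝟙 (j <ᵇ i) * E i j
    E-≤ i j = begin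
      E i j                                    ≡⟨ *-identityʳ (E i j) ⟨
      E i j * 1                                ≤⟨ 𝟙-guard (adj G i j) (λ i~j → ≢⇒1≤𝟙<ᵇ (adj⇒≢ i~j)) ⟩
      E i j * (𝟙 (i <ᵇ j) + 𝟙 (j <ᵇ i))        ≡⟨ spread (E i j) (𝟙 (i <ᵇ j)) (𝟙 (j <ᵇ i)) ⟩
      𝟙 (i <ᵇ j) * E i j + 𝟙 (j <ᵇ i) * E i j  ∎
      where
      open ≤-Reasoning
      spread : ∀ e p q → e * (p + q) ≡ p * e + q * e
      spread = solve-∀

    sum-deg-≤ : sum deg ≤ 2 * edges
    sum-deg-≤ = begin
      ∑₂ E
        ≤⟨ ∑₂-mono-≤ E-≤ ⟩
      ∑₂ (λ i j → 𝟙 (i <ᵇ j) * E i j + 𝟙 (j <ᵇ i) * E i j)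
        ≡⟨ ∑₂-distrib-+ (λ i j → 𝟙 (i <ᵇ j) * E i j) (λ i j → 𝟙 (j <ᵇ i) * E i j) ⟩
      edges + ∑₂ (λ i j → 𝟙 (j <ᵇ i) * E i j)
        ≡⟨ cong (edges +_) reversed ⟩
      edges + edges
        ≡⟨ cong (edges +_) (+-identityʳ edges) ⟨
      2 * edges
        ∎
      where
      open ≤-Reasoning
      reversed : ∑₂ (λ i j → 𝟙 (j <ᵇ i) * E i j) ≡ edges
      reversed = trans (∑-comm (λ i j → 𝟙 (j <ᵇ i) * E i j))
                       (∑₂-cong (λ i j → cong (λ b → 𝟙 (i <ᵇ j) * 𝟙 b) (adj-sym G j i)))

    -- The neighbourhood of an edge

    -- exclNbr u v is A = N(u) ∖ N[v], and exclNbr v u is B.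
    exclNbr : Fin n → Fin n → Fin n → Bool
    exclNbr u v w = adj G u w ∧ not (adj G v w) ∧ not (w ≡ᵇ v)

    crossEdge : Fin n → Fin n → Fin n → Fin n → Bool
    crossEdge u v x y = exclNbr v u x ∧ exclNbr u v y ∧ adj G x y

    crossEdges : Fin n → Fin n → ℕ
    crossEdges u v = ∑₂ (λ x y → 𝟙 (crossEdge u v x y))

    crossEdges-sym : ∀ u v → crossEdges u v ≡ crossEdges v u
    crossEdges-sym u v = trans (∑-comm (λ x y → 𝟙 (crossEdge u v x y))) (∑₂-cong reorder)
      where
      reorder : ∀ y x → 𝟙 (crossEdge u v x y) ≡ 𝟙 (crossEdge v u y x)
      reorder y x = cong 𝟙 (trans (x∙yz≈y∙xz (exclNbr v u x) (exclNbr u v y) (adj G x y))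
                                  (cong (λ b → exclNbr u v y ∧ exclNbr v u x ∧ b) (adj-sym G x y)))

    module _ {u v w : Fin n} (w∈A : T (exclNbr u v w)) where
      exclNbr⇒adj : T (adj G u w)
      exclNbr⇒adj = proj₁ (∧-elim (adj G u w) w∈A)

      exclNbr⇒¬adj : T (adj G v w) → ⊥
      exclNbr⇒¬adj = not-contra (proj₁ (∧-elim (not (adj G v w)) (proj₂ (∧-elim (adj G u w) w∈A))))

      exclNbr⇒≢ : w ≢ v
      exclNbr⇒≢ w≡v = not-contra (proj₂ (∧-elim (not (adj G v w)) (proj₂ (∧-elim (adj G u w) w∈A))))
                                 (does-intro (w ≟ v) w≡v)

    side : Fin n → Fin n → Fin n → ℕ
    side u v w = 𝟙 (w ≡ᵇ u) + 𝟙 (exclNbr u v w)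

    side-𝟙 : ∀ u v w → side u v w ≡ 𝟙 (w ≡ᵇ u ∨ exclNbr u v w)
    side-𝟙 u v w = 𝟙-disjoint (λ w≡u w∈A → adj⇒≢ (exclNbr⇒adj w∈A) (sym (does-elim (w ≟ u) w≡u)))

    sides-≤1 : ∀ {u v} → T (adj G u v) → ∀ w → side u v w + side v u w ≤ 1
    sides-≤1 {u} {v} uv w = begin
      side u v w + side v u w                           ≡⟨ cong₂ _+_ (side-𝟙 u v w) (side-𝟙 v u w) ⟩
      𝟙 (w ≡ᵇ u ∨ exclNbr u v w) + 𝟙 (w ≡ᵇ v ∨ exclNbr v u w)  ≡⟨ 𝟙-disjoint apart ⟩
      𝟙 _                                               ≤⟨ 𝟙-≤1 _ ⟩
      1                                                 ∎
      where
      open ≤-Reasoning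
      apart : T (w ≡ᵇ u ∨ exclNbr u v w) → T (w ≡ᵇ v ∨ exclNbr v u w) → ⊥
      apart p q with ∨-elim {w ≡ᵇ u} p | ∨-elim {w ≡ᵇ v} q
      ... | inj₁ w≡u | inj₁ w≡v = adj⇒≢ uv (trans (sym (does-elim (w ≟ u) w≡u)) (does-elim (w ≟ v) w≡v))
      ... | inj₁ w≡u | inj₂ w∈B = exclNbr⇒≢ w∈B (does-elim (w ≟ u) w≡u)
      ... | inj₂ w∈A | inj₁ w≡v = exclNbr⇒≢ w∈A (does-elim (w ≟ v) w≡v)
      ... | inj₂ w∈A | inj₂ w∈B = exclNbr⇒¬adj w∈A (exclNbr⇒adj w∈B)

    -- The ordered pairs (i , j) seen from the side of u: u → v, u → A, A → u and the edges A → B.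
    sideLinks : Fin n → Fin n → Fin n → Fin n → ℕ
    sideLinks u v i j = 𝟙 (i ≡ᵇ u) * (𝟙 (j ≡ᵇ v) + 𝟙 (exclNbr u v j))
                      + 𝟙 (exclNbr u v i) * 𝟙 (j ≡ᵇ u) + 𝟙 (crossEdge v u i j)

    sideLinks-≤ : ∀ {u v} → T (adj G u v) → ∀ i j → sideLinks u v i j ≤ side u v i * E i j
    sideLinks-≤ {u} {v} uv i j = begin
      sideLinks u v i j
        ≡⟨ regroup ⟩
      𝟙 (i ≡ᵇ u) * (𝟙 (j ≡ᵇ v) + 𝟙 (exclNbr u v j))
        + 𝟙 (exclNbr u v i) * (𝟙 (j ≡ᵇ u) + 𝟙 (exclNbr v u j ∧ adj G i j))
        ≤⟨ +-mono-≤ (𝟙-guard (i ≡ᵇ u) fromU) (𝟙-guard (exclNbr u v i) fromA) ⟩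
      𝟙 (i ≡ᵇ u) * E i j + 𝟙 (exclNbr u v i) * E i j
        ≡⟨ *-distribʳ-+ (E i j) (𝟙 (i ≡ᵇ u)) (𝟙 (exclNbr u v i)) ⟨
      side u v i * E i j
        ∎
      where
      open ≤-Reasoning
      factor : ∀ a b c d → a + b * c + b * d ≡ a + b * (c + d)
      factor = solve-∀
      regroup : sideLinks u v i j ≡ 𝟙 (i ≡ᵇ u) * (𝟙 (j ≡ᵇ v) + 𝟙 (exclNbr u v j))
                  + 𝟙 (exclNbr u v i) * (𝟙 (j ≡ᵇ u) + 𝟙 (exclNbr v u j ∧ adj G i j))
      regroup = trans (cong (𝟙 (i ≡ᵇ u) * (𝟙 (j ≡ᵇ v) + 𝟙 (exclNbr u v j)) + 𝟙 (exclNbr u v i) * 𝟙 (j ≡ᵇ u) +_)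
                            (𝟙-∧ (exclNbr u v i) (exclNbr v u j ∧ adj G i j)))
                      (factor _ (𝟙 (exclNbr u v i)) (𝟙 (j ≡ᵇ u)) _)
      fromU : T (i ≡ᵇ u) → 𝟙 (j ≡ᵇ v) + 𝟙 (exclNbr u v j) ≤ E i j
      fromU i≡u rewrite does-elim (i ≟ u) i≡u =
        𝟙-disjoint-≤ (λ j≡v j∈A → exclNbr⇒≢ j∈A (does-elim (j ≟ v) j≡v))
                     (λ j≡v → subst (T ∘ adj G u) (sym (does-elim (j ≟ v) j≡v)) uv)
                     exclNbr⇒adj
      fromA : T (exclNbr u v i) → 𝟙 (j ≡ᵇ u) + 𝟙 (exclNbr v u j ∧ adj G i j) ≤ E i j
      fromA i∈A =
        𝟙-disjoint-≤ (λ j≡u j∈B → exclNbr⇒≢ (proj₁ (∧-elim (exclNbr v u j) j∈B)) (does-elim (j ≟ u) j≡u))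
                     (λ j≡u → subst (T ∘ adj G i) (sym (does-elim (j ≟ u) j≡u)) (adj-symᵀ (exclNbr⇒adj i∈A)))
                     (proj₂ ∘ ∧-elim (exclNbr v u j))

    ∑₂-sideLinks : ∀ u v → ∑₂ (sideLinks u v) ≡ 1 + 2 * sum (𝟙 ∘ exclNbr u v) + crossEdges v u
    ∑₂-sideLinks u v = begin
      ∑₂ (sideLinks u v)
        ≡⟨ trans (∑₂-distrib-+ (λ i j → fromU i j + intoU i j) (λ i j → 𝟙 (crossEdge v u i j)))
                 (cong (_+ crossEdges v u) (∑₂-distrib-+ fromU intoU)) ⟩
      ∑₂ fromU + ∑₂ intoU + crossEdges v u
        ≡⟨ cong₂ (λ p q → p + q + crossEdges v u) (∑₂-product isU (λ j → isV j + inA j)) (∑₂-product inA isU) ⟩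
      sum isU * sum (λ j → isV j + inA j) + sum inA * sum isU + crossEdges v u
        ≡⟨ cong₂ (λ p q → p * q + sum inA * p + crossEdges v u)
                 (sum-δ u) (trans (∑-distrib-+ isV inA) (cong (_+ sum inA) (sum-δ v))) ⟩
      1 * (1 + sum inA) + sum inA * 1 + crossEdges v u
        ≡⟨ arith (sum inA) (crossEdges v u) ⟩
      1 + 2 * sum inA + crossEdges v u
        ∎
      where
      open ≡-Reasoning
      isU isV inA : Fin n → ℕ
      isU w = 𝟙 (w ≡ᵇ u)
      isV w = 𝟙 (w ≡ᵇ v)
      inA w = 𝟙 (exclNbr u v w)
      fromU intoU : Fin n → Fin n → ℕ
      fromU i j = isU i * (isV j + inA j)
      intoU i j = inA i * isU j
      arith : ∀ a k → 1 * (1 + a) + a * 1 + k ≡ 1 + 2 * a + k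
      arith = solve-∀

    -- Indicator of the vertices outside {u, v} ∪ A ∪ B; the truncated subtraction is exact by sides-≤1.
    rest : Fin n → Fin n → Fin n → ℕ
    rest u v w = 1 ∸ (side u v w + side v u w)

    sum-side : ∀ u v → sum (side u v) ≡ 1 + sum (𝟙 ∘ exclNbr u v)
    sum-side u v = trans (∑-distrib-+ (λ w → 𝟙 (w ≡ᵇ u)) (𝟙 ∘ exclNbr u v)) (cong (_+ sum (𝟙 ∘ exclNbr u v)) (sum-δ u))

    module _ {u v : Fin n} (uv : T (adj G u v)) where

      partition : ∀ w → side u v w + side v u w + rest u v w ≡ 1
      partition w = m+[n∸m]≡n (sides-≤1 uv w)

      vertexCount : n ≡ 1 + sum (𝟙 ∘ exclNbr u v) + (1 + sum (𝟙 ∘ exclNbr v u)) + sum (rest u v)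
      vertexCount = begin
        n
          ≡⟨ sum-ones n ⟨
        sum {n} (λ _ → 1)
          ≡⟨ sum-cong-≗ partition ⟨
        sum (λ w → side u v w + side v u w + rest u v w)
          ≡⟨ trans (∑-distrib-+ (λ w → side u v w + side v u w) (rest u v))
                   (cong (_+ sum (rest u v)) (∑-distrib-+ (side u v) (side v u))) ⟩
        sum (side u v) + sum (side v u) + sum (rest u v)
          ≡⟨ cong₂ (λ p q → p + q + sum (rest u v)) (sum-side u v) (sum-side v u) ⟩
        1 + sum (𝟙 ∘ exclNbr u v) + (1 + sum (𝟙 ∘ exclNbr v u)) + sum (rest u v)
          ∎
        where open ≡-Reasoning

      deg-≥ : (∀ w → 2 ≤ deg w) → ∀ i →
              sum (λ j → sideLinks u v i j + sideLinks v u i j) + 2 * rest u v i ≤ deg i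
      deg-≥ δ i = begin
        sum (λ j → sideLinks u v i j + sideLinks v u i j) + 2 * rest u v i
          ≤⟨ +-mono-≤ (sum-mono-≤ (λ j → +-mono-≤ (sideLinks-≤ uv i j) (sideLinks-≤ (adj-symᵀ uv) i j)))
                      (*-monoˡ-≤ (rest u v i) (δ i)) ⟩
        sum (λ j → side u v i * E i j + side v u i * E i j) + deg i * rest u v i
          ≡⟨ cong₂ _+_ (trans (∑-distrib-+ (λ j → side u v i * E i j) (λ j → side v u i * E i j))
                              (sym (cong₂ _+_ (*-distribˡ-sum (side u v i) (E i)) (*-distribˡ-sum (side v u i) (E i)))))
                       (*-comm (deg i) (rest u v i)) ⟩
        side u v i * deg i + side v u i * deg i + rest u v i * deg i
          ≡⟨ trans (factor (side u v i) (side v u i) (rest u v i) (deg i)) (cong (_* deg i) (partition i)) ⟩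
        1 * deg i
          ≡⟨ *-identityˡ (deg i) ⟩
        deg i
          ∎
        where
        open ≤-Reasoning
        factor : ∀ s t r d → s * d + t * d + r * d ≡ (s + t + r) * d
        factor = solve-∀

      crossEdges-bound : (∀ w → 2 ≤ deg w) → crossEdges u v + n ≤ edges + 1
      crossEdges-bound δ = *-cancelˡ-≤ 2 (begin
        2 * (k + n)
          ≡⟨ cong (λ m → 2 * (k + m)) vertexCount ⟩
        2 * (k + (1 + a + (1 + b) + o))
          ≡⟨ arith k a b o ⟩
        (1 + 2 * a + k) + (1 + 2 * b + k) + 2 * o + 2
          ≡⟨ cong₂ (λ p q → p + q + 2 * o + 2)
                   (trans (cong (1 + 2 * a +_) (crossEdges-sym u v)) (sym (∑₂-sideLinks u v)))
                   (sym (∑₂-sideLinks v u)) ⟩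
        ∑₂ (sideLinks u v) + ∑₂ (sideLinks v u) + 2 * o + 2
          ≡⟨ cong (_+ 2) (trans (cong₂ _+_ (sym (∑₂-distrib-+ (sideLinks u v) (sideLinks v u)))
                                           (*-distribˡ-sum 2 (rest u v)))
                                (sym (∑-distrib-+ (λ i → sum (λ j → sideLinks u v i j + sideLinks v u i j))
                                                  (λ i → 2 * rest u v i)))) ⟩
        sum (λ i → sum (λ j → sideLinks u v i j + sideLinks v u i j) + 2 * rest u v i) + 2
          ≤⟨ +-monoˡ-≤ 2 (sum-mono-≤ (deg-≥ δ)) ⟩
        sum deg + 2
          ≤⟨ +-monoˡ-≤ 2 sum-deg-≤ ⟩
        2 * edges + 2
          ≡⟨ *-distribˡ-+ 2 edges 1 ⟨
        2 * (edges + 1)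
          ∎)
        where
        open ≤-Reasoning
        k = crossEdges u v
        a = sum (𝟙 ∘ exclNbr u v)
        b = sum (𝟙 ∘ exclNbr v u)
        o = sum (rest u v)
        arith : ∀ k a b o → 2 * (k + (1 + a + (1 + b) + o)) ≡ (1 + 2 * a + k) + (1 + 2 * b + k) + 2 * o + 2
        arith = solve-∀

    ∑-crossEdges-≤ : (∀ w → 2 ≤ deg w) →
                     ∑₂ (λ u v → 𝟙 (u <ᵇ v) * E u v * crossEdges u v) + edges * n ≤ edges * (edges + 1)
    ∑-crossEdges-≤ δ = begin
      ∑₂ (λ u v → e u v * crossEdges u v) + edges * n
        ≡⟨ cong (∑₂ (λ u v → e u v * crossEdges u v) +_) (∑₂-*ʳ n e) ⟨
      ∑₂ (λ u v → e u v * crossEdges u v) + ∑₂ (λ u v → e u v * n)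
        ≡⟨ ∑₂-distrib-+ (λ u v → e u v * crossEdges u v) (λ u v → e u v * n) ⟨
      ∑₂ (λ u v → e u v * crossEdges u v + e u v * n)
        ≡⟨ ∑₂-cong (λ u v → *-distribˡ-+ (e u v) (crossEdges u v) n) ⟨
      ∑₂ (λ u v → e u v * (crossEdges u v + n))
        ≤⟨ ∑₂-mono-≤ bound ⟩
      ∑₂ (λ u v → e u v * (edges + 1))
        ≡⟨ ∑₂-*ʳ (edges + 1) e ⟩
      edges * (edges + 1)
        ∎
      where
      open ≤-Reasoning
      e : Fin n → Fin n → ℕ
      e u v = 𝟙 (u <ᵇ v) * E u v
      bound : ∀ u v → e u v * (crossEdges u v + n) ≤ e u v * (edges + 1)
      bound u v = begin
        e u v * (crossEdges u v + n)            ≡⟨ *-assoc (𝟙 (u <ᵇ v)) (E u v) (crossEdges u v + n) ⟩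
        𝟙 (u <ᵇ v) * (E u v * (crossEdges u v + n))
          ≤⟨ *-monoʳ-≤ (𝟙 (u <ᵇ v)) (𝟙-guard (adj G u v) (λ uv → crossEdges-bound uv δ)) ⟩
        𝟙 (u <ᵇ v) * (E u v * (edges + 1))      ≡⟨ *-assoc (𝟙 (u <ᵇ v)) (E u v) (edges + 1) ⟨
        e u v * (edges + 1)                     ∎

    -- Induced 4-cycles

    inducedC4Through : Fin n → Fin n → Fin n → Fin n → ℕ
    inducedC4Through u v x y = E u v * (𝟙 (crossEdge u v x y) + 𝟙 (crossEdge u v y x))

    ∑-inducedC4Through-≤ : ∑₄ (λ u v x y → 𝟙 (u <ᵇ v) * 𝟙 (x <ᵇ y) * inducedC4Through u v x y)
                           ≤ ∑₂ (λ u v → 𝟙 (u <ᵇ v) * E u v * crossEdges u v)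
    ∑-inducedC4Through-≤ = begin
      ∑₄ (λ u v x y → 𝟙 (u <ᵇ v) * 𝟙 (x <ᵇ y) * inducedC4Through u v x y)
        ≡⟨ ∑₂-cong (λ u v → trans (∑₂-cong (λ x y → regroup (𝟙 (u <ᵇ v)) (𝟙 (x <ᵇ y)) (E u v) (both u v x y)))
                                  (∑₂-*ˡ (𝟙 (u <ᵇ v) * E u v) (through u v))) ⟩
      ∑₂ (λ u v → 𝟙 (u <ᵇ v) * E u v * ∑₂ (through u v))
        ≤⟨ ∑₂-mono-≤ (λ u v → *-monoʳ-≤ (𝟙 (u <ᵇ v) * E u v)
                        (∑₂-symmetrise (λ x y → 𝟙 (crossEdge u v x y)))) ⟩
      ∑₂ (λ u v → 𝟙 (u <ᵇ v) * E u v * crossEdges u v)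
        ∎
      where
      open ≤-Reasoning
      both through : Fin n → Fin n → Fin n → Fin n → ℕ
      both u v x y = 𝟙 (crossEdge u v x y) + 𝟙 (crossEdge u v y x)
      through u v x y = 𝟙 (x <ᵇ y) * both u v x y
      regroup : ∀ p q e s → p * q * (e * s) ≡ p * e * (q * s)
      regroup = solve-∀

    cyc-elim : ∀ a x y z → T (cyc G a x y z) →
               T (adj G a x) × T (adj G x y) × T (adj G y z) × T (adj G z a)
               × T (not (adj G a y)) × T (not (adj G x z))
    cyc-elim a x y z c =
      let ax , c₁ = ∧-elim (adj G a x) c
          xy , c₂ = ∧-elim (adj G x y) c₁
          yz , c₃ = ∧-elim (adj G y z) c₂
          za , c₄ = ∧-elim (adj G z a) c₃
      in ax , xy , yz , za , ∧-elim (not (adj G a y)) c₄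

    cyc-intro : ∀ {a x y z} → T (adj G a x) → T (adj G x y) → T (adj G y z) → T (adj G z a)
                → T (not (adj G a y)) → T (not (adj G x z)) → T (cyc G a x y z)
    cyc-intro ax xy yz za a≁y x≁z =
      ∧-intro ax (∧-intro xy (∧-intro yz (∧-intro za (∧-intro a≁y x≁z))))

    cyc-rotate : ∀ a x y z → T (cyc G a x y z) → T (cyc G x y z a)
    cyc-rotate a x y z c = let ax , xy , yz , za , a≁y , x≁z = cyc-elim a x y z c in
      cyc-intro xy yz za ax x≁z (¬adj-symᵀ a≁y)

    cyc-reverse : ∀ a x y z → T (cyc G a x y z) → T (cyc G a z y x)
    cyc-reverse a x y z c = let ax , xy , yz , za , a≁y , x≁z = cyc-elim a x y z c in
      cyc-intro (adj-symᵀ za) (adj-symᵀ yz) (adj-symᵀ xy) (adj-symᵀ ax) a≁y (¬adj-symᵀ x≁z)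

    cyc⇒crossEdge : ∀ {u v x y} → x ≢ u → y ≢ v → T (cyc G u v x y) → T (adj G u v ∧ crossEdge u v x y)
    cyc⇒crossEdge {u} {v} {x} {y} x≢u y≢v c = let uv , vx , xy , yu , u≁x , v≁y = cyc-elim u v x y c in
      ∧-intro uv (∧-intro (∧-intro vx (∧-intro u≁x (does-introFalse (x ≟ u) x≢u)))
                          (∧-intro (∧-intro (adj-symᵀ yu) (∧-intro v≁y (does-introFalse (y ≟ v) y≢v))) xy))

    cycles-≤-inducedC4Through : ∀ {u v x y} → x ≢ u → y ≢ v → y ≢ u → x ≢ v →
      𝟙 (cyc G u v x y) + 𝟙 (cyc G u v y x) ≤ inducedC4Through u v x y
    cycles-≤-inducedC4Through {u} {v} {x} {y} x≢u y≢v y≢u x≢v = begin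
      𝟙 (cyc G u v x y) + 𝟙 (cyc G u v y x)
        ≤⟨ +-mono-≤ (𝟙-mono (cyc⇒crossEdge x≢u y≢v)) (𝟙-mono (cyc⇒crossEdge y≢u x≢v)) ⟩
      𝟙 (adj G u v ∧ crossEdge u v x y) + 𝟙 (adj G u v ∧ crossEdge u v y x)
        ≡⟨ cong₂ _+_ (𝟙-∧ (adj G u v) _) (𝟙-∧ (adj G u v) _) ⟩
      E u v * 𝟙 (crossEdge u v x y) + E u v * 𝟙 (crossEdge u v y x)
        ≡⟨ *-distribˡ-+ (E u v) _ _ ⟨
      inducedC4Through u v x y
        ∎
      where open ≤-Reasoning

    -- Each of the three 4-cycles on {a, b, c, d} occurs four times among the twelve rooted
    -- cycles of the splits, once through each of its edges.
    inducesC4-≤-splits : ∀ {a b c d} → a < b → b < c → c < d →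
                         4 * 𝟙 (inducesC4 G (a , b , c , d)) ≤ splits inducedC4Through a b c d
    inducesC4-≤-splits {a} {b} {c} {d} a<b b<c c<d = begin
      4 * 𝟙 (c₁ ∨ c₂ ∨ c₃)
        ≤⟨ *-monoʳ-≤ 4 (≤-trans (𝟙-∨-≤ c₁ (c₂ ∨ c₃)) (+-monoʳ-≤ (𝟙 c₁) (𝟙-∨-≤ c₂ c₃))) ⟩
      4 * (𝟙 c₁ + (𝟙 c₂ + 𝟙 c₃))
        ≡⟨ spread (𝟙 c₁) (𝟙 c₂) (𝟙 c₃) ⟩
      (𝟙 c₁ + 𝟙 c₂) + (𝟙 c₃ + 𝟙 c₂) + (𝟙 c₃ + 𝟙 c₁) + (𝟙 c₃ + 𝟙 c₁) + (𝟙 c₃ + 𝟙 c₂) + (𝟙 c₁ + 𝟙 c₂)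
        ≤⟨ +-mono-≤ (+-mono-≤ (+-mono-≤ (+-mono-≤ (+-mono-≤
             (through (>⇒≢ a<c) (>⇒≢ b<d) (>⇒≢ a<d) (>⇒≢ b<c) id id)
             (through (>⇒≢ a<b) (>⇒≢ c<d) (>⇒≢ a<d) (<⇒≢ b<c) id (cyc-reverse a b d c)))
             (through (>⇒≢ a<b) (<⇒≢ c<d) (>⇒≢ a<c) (<⇒≢ b<d) (cyc-reverse a c b d) (cyc-reverse a b c d)))
             (through (<⇒≢ a<b) (>⇒≢ c<d) (>⇒≢ b<d) (<⇒≢ a<c)
                      (cyc-rotate d b c a ∘ cyc-rotate a d b c ∘ cyc-reverse a c b d) (cyc-rotate a b c d)))
             (through (<⇒≢ a<b) (<⇒≢ c<d) (>⇒≢ b<c) (<⇒≢ a<d)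
                      (cyc-rotate c b d a ∘ cyc-rotate a c b d) (cyc-rotate a b d c)))
             (through (<⇒≢ a<c) (<⇒≢ b<d) (<⇒≢ b<c) (<⇒≢ a<d)
                      (cyc-rotate b c d a ∘ cyc-rotate a b c d) (cyc-rotate a c d b ∘ cyc-reverse a b d c)) ⟩
      splits inducedC4Through a b c d
        ∎
      where
      open ≤-Reasoning
      c₁ = cyc G a b c d
      c₂ = cyc G a b d c
      c₃ = cyc G a c b d
      a<c = <-trans a<b b<c
      a<d = <-trans a<c c<d
      b<d = <-trans b<c c<d
      >⇒≢ : ∀ {i j : Fin n} → i < j → j ≢ i
      >⇒≢ i<j = ≢-sym (<⇒≢ i<j)
      spread : ∀ k₁ k₂ k₃ → 4 * (k₁ + (k₂ + k₃))
               ≡ (k₁ + k₂) + (k₃ + k₂) + (k₃ + k₁) + (k₃ + k₁) + (k₃ + k₂) + (k₁ + k₂)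
      spread = solve-∀
      through : ∀ {u v x y p q} → x ≢ u → y ≢ v → y ≢ u → x ≢ v →
                (T p → T (cyc G u v x y)) → (T q → T (cyc G u v y x)) → 𝟙 p + 𝟙 q ≤ inducedC4Through u v x y
      through x≢u y≢v y≢u x≢v p⇒ q⇒ =
        ≤-trans (+-mono-≤ (𝟙-mono p⇒) (𝟙-mono q⇒)) (cycles-≤-inducedC4Through x≢u y≢v y≢u x≢v)

    NindC4≡ : NindC4 G ≡ ∑₄ (λ a b c d → 𝟙 (sorted a b c d ∧ inducesC4 G (a , b , c , d)))
    NindC4≡ =
      trans (length-filter-concatMap C4 (λ a → concatMap (q₂ a) (allFin n)) id) (sum-cong-≗ λ a →
      trans (length-filter-concatMap C4 (q₂ a) id) (sum-cong-≗ λ b →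
      trans (length-filter-concatMap C4 (q₃ a b) id) (sum-cong-≗ λ c →
      trans (length-filter-concatMap C4 (q₄ a b c) id) (sum-cong-≗ λ d →
      length-filter-if C4 (sorted a b c d) (a , b , c , d)))))
      where
      C4 : Quad n → Bool
      C4 = inducesC4 G
      q₄ : Fin n → Fin n → Fin n → Fin n → List (Quad n)
      q₄ a b c d = if sorted a b c d then (a , b , c , d) ∷ [] else []
      q₃ : Fin n → Fin n → Fin n → List (Quad n)
      q₃ a b c = concatMap (q₄ a b c) (allFin n)
      q₂ : Fin n → Fin n → List (Quad n)
      q₂ a b = concatMap (q₃ a b) (allFin n)

    4NindC4-≤ : 4 * NindC4 G ≤ ∑₄ (λ u v x y → 𝟙 (u <ᵇ v) * 𝟙 (x <ᵇ y) * inducedC4Through u v x y)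
    4NindC4-≤ = begin
      4 * NindC4 G
        ≡⟨ trans (cong (4 *_) NindC4≡) (sym (∑₄-*ˡ 4 (λ a b c d → 𝟙 (sorted a b c d ∧ inducesC4 G (a , b , c , d))))) ⟩
      ∑₄ (λ a b c d → 4 * 𝟙 (sorted a b c d ∧ inducesC4 G (a , b , c , d)))
        ≤⟨ ∑₄-mono-≤ quad-≤ ⟩
      ∑₄ (λ a b c d → 𝟙 (sorted a b c d) * splits inducedC4Through a b c d)
        ≤⟨ ∑₄-splits-≤ inducedC4Through ⟩
      ∑₄ (λ u v x y → 𝟙 (u <ᵇ v) * 𝟙 (x <ᵇ y) * inducedC4Through u v x y)
        ∎
      where
      open ≤-Reasoning
      *-left-swap : ∀ k s c → k * (s * c) ≡ s * (k * c)
      *-left-swap = solve-∀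
      quad-≤ : ∀ a b c d → 4 * 𝟙 (sorted a b c d ∧ inducesC4 G (a , b , c , d))
                           ≤ 𝟙 (sorted a b c d) * splits inducedC4Through a b c d
      quad-≤ a b c d = begin
        4 * 𝟙 (sorted a b c d ∧ inducesC4 G (a , b , c , d))
          ≡⟨ trans (cong (4 *_) (𝟙-∧ (sorted a b c d) _)) (*-left-swap 4 (𝟙 (sorted a b c d)) _) ⟩
        𝟙 (sorted a b c d) * (4 * 𝟙 (inducesC4 G (a , b , c , d)))
          ≤⟨ 𝟙-guard (sorted a b c d) (λ s → let a<b , b<c , c<d = sorted-elim a b c d s in
                                             inducesC4-≤-splits a<b b<c c<d) ⟩
        𝟙 (sorted a b c d) * splits inducedC4Through a b c d
          ∎

    inducedC4-bound : (∀ v → 2 ≤ degree G v) → 4 * NindC4 G + edgeCount G * n ≤ edgeCount G * (edgeCount G + 1)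
    inducedC4-bound δ rewrite edgeCount≡edges =
      ≤-trans (+-monoˡ-≤ (edges * n) (≤-trans 4NindC4-≤ ∑-inducedC4Through-≤))
              (∑-crossEdges-≤ (λ v → subst (2 ≤_) (degree≡deg v) (δ v)))

open import Defs
open import Data.Nat using (ℕ; _≤_; _>_)
open import Data.Fin using (Fin)
open import Data.Integer using (ℤ; +_; _*_; _-_; _+_)
import Data.Integer as ℤ
open import Relation.Binary.PropositionalEquality using (_≡_)

import Data.Nat as ℕ
open import Data.Integer using (-_; +≤+)
open import Data.Integer.Properties using (pos-+; pos-*; +-monoˡ-≤; module ≤-Reasoning)
open import Data.Integer.Tactic.RingSolver using (solve-∀)
open import Relation.Binary.PropositionalEquality using (refl; cong; cong₂; trans)
open C4Counting using (inducedC4-bound)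

ℕ-bound⇒ℤ : ∀ {k m n} → 4 ℕ.* k ℕ.+ m ℕ.* n ≤ m ℕ.* (m ℕ.+ 1) → + 4 * + k ℤ.≤ + m * (+ m - + n + + 1)
ℕ-bound⇒ℤ {k} {m} {n} h = begin
  + 4 * + k                                  ≡⟨ cancel (+ 4 * + k) (+ m * + n) ⟨
  + 4 * + k + + m * + n - + m * + n          ≡⟨ cong (_- + m * + n) (trans (pos-+ (4 ℕ.* k) (m ℕ.* n))
                                                     (cong₂ _+_ (pos-* 4 k) (pos-* m n))) ⟨
  + (4 ℕ.* k ℕ.+ m ℕ.* n) - + m * + n        ≤⟨ +-monoˡ-≤ (- (+ m * + n)) (+≤+ h) ⟩
  + (m ℕ.* (m ℕ.+ 1)) - + m * + n            ≡⟨ cong (_- + m * + n) (trans (pos-* m (m ℕ.+ 1))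
                                                     (cong (+ m *_) (pos-+ m 1))) ⟩
  + m * (+ m + + 1) - + m * + n              ≡⟨ factor (+ m) (+ n) ⟩
  + m * (+ m - + n + + 1)                    ∎
  where
  open ≤-Reasoning
  cancel : ∀ x y → x + y - y ≡ x
  cancel = solve-∀
  factor : ∀ x y → x * (x + + 1) - x * y ≡ x * (x - y + + 1)
  factor = solve-∀

lemma6p2 : (n m : ℕ) → n > 0 → m > 3 → (G : Graph n) → edgeCount G ≡ m
    → ((v : Fin n) → 2 ≤ degree G v)
    → + 4 * + NindC4 G ℤ.≤ + m * (+ m - + n + + 1)
lemma6p2 n _ _ _ G refl δ = ℕ-bound⇒ℤ {NindC4 G} {edgeCount G} {n} (inducedC4-bound G δ)
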